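{- Let $2\le k\le n$ be integers, $m=\lceil (n-k)/2\rceil$, and let $s$ be an integer. Then: (I) $w_s = 0$ if $s<0$ or $s>n-k+1$, and $w_s>0$ if $0\le s\le n-k+1$; (II) if $0 \le s \le m$ or $m+k \le s \le n$, then $\sum_{i = s-k+1}^{s}w_i = \binom{n}{s}$; (III) if $m < s < m+k$, then $\sum_{i = s-k+1}^{s}w_i= S(n,k,m) - S(n,k,s) + \binom{n}{s}$; (IV) $\sum_{i=0}^{n-k+1}w_i=S(n,k,m)$.
   Context: For integers $r$, $S(n,k,r) = \sum_{0\le i\le n,\ i \equiv r \pmod k}\binom{n}{i}$. For integers $r,z$ with $z\equiv r \pmod k$, $S(n,k,r\mid z) = \sum_{0\le i\le n,\ i\equiv r \pmod k,\ i\le z}\binom{n}{i}$ (an empty sum being $0$). For every integer $i$, define $w_i = S(n,k,i\mid i) - S(n,k,i-1\mid i-1)$ if $i\le m$, and $w_i = S(n,k,n-i-k+1\mid n-i-k+1) - S(n,k,n-i-k\mid n-i-k)$ if $i\ge m+1$. -}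

module Defs where

open import Data.Nat as ℕ using (ℕ; zero; suc; _∸_; _/_)
open import Data.Nat.Combinatorics using (_C_)
open import Data.Integer as ℤ using (ℤ; +_; _-_; _%ℕ_; _≤?_)
open import Data.Bool using (Bool; true; false; if_then_else_; _∧_)
open import Relation.Nullary using (does)

-- i ≡ r (mod k) for integers i, r and a modulus k ≥ 1 (k = 0 never occurs here)
congᵇ : ℕ → ℤ → ℤ → Bool
congᵇ zero    i r = does (i ℤ.≟ r)
congᵇ (suc k) i r = ((i - r) %ℕ suc k) ℕ.≡ᵇ 0

Sup : ℕ → ℕ → ℤ → ℤ → ℕ → ℤ
Sup n k r z zero    = if congᵇ k (+ 0) r ∧ does (+ 0 ≤? z) then + (n C 0) else + 0
Sup n k r z (suc j) =
  (if congᵇ k (+ suc j) r ∧ does (+ suc j ≤? z) then + (n C suc j) else + 0)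
  ℤ.+ Sup n k r z j

-- S(n,k,r | z) = Σ_{0 ≤ i ≤ n, i ≡ r (mod k), i ≤ z} C(n,i)
-- (the paper only uses it for z ≡ r (mod k); here z is arbitrary)
Sbar : ℕ → ℕ → ℤ → ℤ → ℤ
Sbar n k r z = Sup n k r z n

S : ℕ → ℕ → ℤ → ℤ
S n k r = Sbar n k r (+ n)

-- binomial coefficient C(n, s) for an integer s (0 for s < 0; C(n,s)=0 for s > n anyway)
binomℤ : ℕ → ℤ → ℤ
binomℤ n (+ s)      = + (n C s)
binomℤ n ℤ.-[1+ _ ] = + 0

-- m = ⌈(n - k)/2⌉ (for k ≤ n)
mOf : ℕ → ℕ → ℕ
mOf n k = (n ∸ k ℕ.+ 1) / 2

w : ℕ → ℕ → ℤ → ℤ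
w n k i =
  if does (i ≤? + mOf n k)
  then Sbar n k i i ℤ.- Sbar n k (i - + 1) (i - + 1)
  else Sbar n k j j ℤ.- Sbar n k (j - + 1) (j - + 1)
  where j = + n - i - + k ℤ.+ + 1

-- Σ_{i = s-k+1}^{s} f i  (k terms: f s, f (s-1), ..., f (s-k+1))
sumWindow : (ℤ → ℤ) → ℤ → ℕ → ℤ
sumWindow f s zero    = + 0
sumWindow f s (suc j) = f (s - + j) ℤ.+ sumWindow f s j

sumTo : (ℤ → ℤ) → ℕ → ℤ
sumTo f zero    = f (+ 0)
sumTo f (suc N) = f (+ suc N) ℤ.+ sumTo f N

-- Write T(i) = S(n,k,i | i). Removing the largest index of its residue class gives
-- T(p) = C(n,p) + T(p-k) for 0 ≤ p ≤ n, T vanishes at negative arguments, and the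
-- reflection i ↦ n - i splits S(n,k,p) = T(p) + T(n-p-k). By definition w_i is the
-- backward difference ΔT(i) for i ≤ m and ΔT(c-i), c = n-k+1, for i > m, so a window
-- of k consecutive w's telescopes: below m to T(s) - T(s-k) = C(n,s), above m+k to the
-- mirror image of this, and across m to T(m) + T(n-m-k) - T(s-k) - T(n-s-k), which the
-- two identities turn into S(n,k,m) - S(n,k,s) + C(n,s); the full sum (IV) is the same
-- computation with both ends of the window at -1. For positivity,
-- ΔT(p) = (C(n,p) - C(n,p-1)) + ΔT(p-k) > 0 whenever 2p < n, by strong induction on p,
-- since binomial coefficients increase up to the middle; w only evaluates ΔT there.

module Submission where

open import Data.Bool using (Bool; T; if_then_else_; _∧_)
open import Data.Bool.Properties using (∧-zeroʳ)
open import Data.Integer as ℤ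
  using (ℤ; +_; _+_; _-_; -_; _*_; _<_; _≤_; _>_; _≤?_; +≤+; +<+; -<+; 0ℤ; -1ℤ; ∣_∣)
open import Data.Integer.DivMod using (a≡a%ℕn+[a/ℕn]*n; n%ℕd<d)
open import Data.Integer.Divisibility.Signed
  using (_∣_; divides; ∣⇒∣ᵤ; ∣m⇒∣-m; ∣m∣n⇒∣m+n; ∣m∣n⇒∣m-n; ∣-refl)
import Data.Integer.Properties as ℤP
open ℤP using (i≤j⇒0≤j-i)
open import Data.Integer.Tactic.RingSolver using (solve-∀)
open import Data.Nat as ℕ using (ℕ; zero; suc; z≤n; s≤s)
open import Data.Nat.Combinatorics using (_C_; nC1≡n; nCk≡nC[n∸k]; nCk+nC[k+1]≡[n+1]C[k+1])
import Data.Nat.Divisibility as ℕ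
open import Data.Nat.DivMod using (m≡m%n+[m/n]*n; m/n*n≤m; m%n<n; m/n≤m)
open import Data.Nat.Induction using (<-rec)
import Data.Nat.Properties as ℕP
import Data.Nat.Tactic.RingSolver as ℕ-Solver
open import Data.Product using (_×_; _,_; proj₁; proj₂)
open import Data.Sum using (_⊎_; inj₁; inj₂)
open import Relation.Nullary using (Dec; yes; no; does; proof; ¬_; contradiction)
open import Relation.Nullary.Decidable using (dec-true; dec-false)
open import Relation.Nullary.Reflects using (Reflects; ofʸ; ofⁿ; fromEquivalence; _×-reflects_)
open import Relation.Binary.PropositionalEquality
  using (_≡_; refl; sym; trans; cong; cong₂; subst; subst₂; module ≡-Reasoning)

open import Defs

[1+k]*[1+n]C[1+k]≡[1+n]*nCk : ∀ n k → suc k ℕ.* (suc n C suc k) ≡ suc n ℕ.* (n C k)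
[1+k]*[1+n]C[1+k]≡[1+n]*nCk zero    zero    = refl
[1+k]*[1+n]C[1+k]≡[1+n]*nCk zero    (suc k) = ℕP.*-zeroʳ (suc (suc k))
[1+k]*[1+n]C[1+k]≡[1+n]*nCk (suc n) zero    =
  trans (ℕP.*-identityˡ _) (trans (nC1≡n (suc (suc n))) (sym (ℕP.*-identityʳ _)))
[1+k]*[1+n]C[1+k]≡[1+n]*nCk (suc n) (suc k) = begin
  suc k′ ℕ.* (suc n′ C suc k′)
    ≡⟨ cong (suc k′ ℕ.*_) (nCk+nC[k+1]≡[n+1]C[k+1] n′ k′) ⟨
  suc k′ ℕ.* (n′ C k′ ℕ.+ n′ C suc k′)
    ≡⟨ distribute k′ (n′ C k′) (n′ C suc k′) ⟩
  k′ ℕ.* (n′ C k′) ℕ.+ n′ C k′ ℕ.+ suc k′ ℕ.* (n′ C suc k′)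
    ≡⟨ cong₂ (λ x y → x ℕ.+ n′ C k′ ℕ.+ y)
             ([1+k]*[1+n]C[1+k]≡[1+n]*nCk n k) ([1+k]*[1+n]C[1+k]≡[1+n]*nCk n k′) ⟩
  n′ ℕ.* (n C k) ℕ.+ n′ C k′ ℕ.+ n′ ℕ.* (n C k′)
    ≡⟨ collect n′ (n C k) (n C k′) (n′ C k′) ⟩
  n′ ℕ.* (n C k ℕ.+ n C k′) ℕ.+ n′ C k′
    ≡⟨ cong (λ x → n′ ℕ.* x ℕ.+ n′ C k′) (nCk+nC[k+1]≡[n+1]C[k+1] n k) ⟩
  n′ ℕ.* (n′ C k′) ℕ.+ n′ C k′
    ≡⟨ ℕP.+-comm (n′ ℕ.* (n′ C k′)) (n′ C k′) ⟩
  suc n′ ℕ.* (n′ C k′)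
    ∎
  where
  open ≡-Reasoning
  n′ k′ : ℕ
  n′ = suc n
  k′ = suc k
  distribute : ∀ k a b → suc k ℕ.* (a ℕ.+ b) ≡ k ℕ.* a ℕ.+ a ℕ.+ suc k ℕ.* b
  distribute = ℕ-Solver.solve-∀
  collect : ∀ n a b c → n ℕ.* a ℕ.+ c ℕ.+ n ℕ.* b ≡ n ℕ.* (a ℕ.+ b) ℕ.+ c
  collect = ℕ-Solver.solve-∀

[1+k]*nC[1+k]+k*nCk≡n*nCk : ∀ n k → suc k ℕ.* (n C suc k) ℕ.+ k ℕ.* (n C k) ≡ n ℕ.* (n C k)
[1+k]*nC[1+k]+k*nCk≡n*nCk zero    zero    = refl
[1+k]*nC[1+k]+k*nCk≡n*nCk zero    (suc k) =
  cong₂ ℕ._+_ (ℕP.*-zeroʳ (suc (suc k))) (ℕP.*-zeroʳ (suc k))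
[1+k]*nC[1+k]+k*nCk≡n*nCk (suc n) zero    =
  trans (ℕP.+-identityʳ _) ([1+k]*[1+n]C[1+k]≡[1+n]*nCk n 0)
[1+k]*nC[1+k]+k*nCk≡n*nCk (suc n) (suc k) = begin
  suc (suc k) ℕ.* (suc n C suc (suc k)) ℕ.+ suc k ℕ.* (suc n C suc k)
    ≡⟨ cong₂ ℕ._+_ ([1+k]*[1+n]C[1+k]≡[1+n]*nCk n (suc k)) ([1+k]*[1+n]C[1+k]≡[1+n]*nCk n k) ⟩
  suc n ℕ.* (n C suc k) ℕ.+ suc n ℕ.* (n C k)
    ≡⟨ ℕP.*-distribˡ-+ (suc n) (n C suc k) (n C k) ⟨
  suc n ℕ.* (n C suc k ℕ.+ n C k)
    ≡⟨ cong (suc n ℕ.*_) (ℕP.+-comm (n C suc k) (n C k)) ⟩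
  suc n ℕ.* (n C k ℕ.+ n C suc k)
    ≡⟨ cong (suc n ℕ.*_) (nCk+nC[k+1]≡[n+1]C[k+1] n k) ⟩
  suc n ℕ.* (suc n C suc k)
    ∎
  where open ≡-Reasoning

nCk>0 : ∀ {n k} → k ℕ.≤ n → 0 ℕ.< n C k
nCk>0 {n}     {zero}  _         = s≤s z≤n
nCk>0 {suc n} {suc k} (s≤s k≤n) =
  subst (0 ℕ.<_) (nCk+nC[k+1]≡[n+1]C[k+1] n k) (ℕP.<-≤-trans (nCk>0 k≤n) (ℕP.m≤m+n _ _))

nCk<nC[1+k] : ∀ {n k} → 2 ℕ.* suc k ℕ.≤ n → n C k ℕ.< n C suc k
nCk<nC[1+k] {n} {k} 2[1+k]≤n = ℕP.≰⇒> λ next≤this → ℕP.<-irrefl refl (begin-strict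
  n ℕ.* this                               ≡⟨ [1+k]*nC[1+k]+k*nCk≡n*nCk n k ⟨
  suc k ℕ.* next ℕ.+ k ℕ.* this            ≤⟨ ℕP.+-monoˡ-≤ (k ℕ.* this) (ℕP.*-monoʳ-≤ (suc k) next≤this) ⟩
  suc k ℕ.* this ℕ.+ k ℕ.* this            <⟨ ℕP.m<m+n _ (nCk>0 k≤n) ⟩
  suc k ℕ.* this ℕ.+ k ℕ.* this ℕ.+ this   ≡⟨ regroup k this ⟩
  2 ℕ.* suc k ℕ.* this                     ≤⟨ ℕP.*-monoˡ-≤ this 2[1+k]≤n ⟩
  n ℕ.* this                               ∎)
  where
  open ℕP.≤-Reasoning
  this next : ℕ
  this = n C k
  next = n C suc k
  k≤n : k ℕ.≤ n
  k≤n = ℕP.≤-trans (ℕP.n≤1+n k) (ℕP.≤-trans (ℕP.m≤m+n (suc k) _) 2[1+k]≤n)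
  regroup : ∀ k c → suc k ℕ.* c ℕ.+ k ℕ.* c ℕ.+ c ≡ 2 ℕ.* suc k ℕ.* c
  regroup = ℕ-Solver.solve-∀

+m-+n≡+[m∸n] : ∀ {m n} → n ℕ.≤ m → + m - + n ≡ + (m ℕ.∸ n)
+m-+n≡+[m∸n] {m} {n} n≤m = trans (ℤP.m-n≡m⊖n m n) (ℤP.⊖-≥ n≤m)

binomℤ-sym : ∀ n {i} → 0ℤ ≤ i → i ≤ + n → binomℤ n (+ n - i) ≡ binomℤ n i
binomℤ-sym n {+ i} _ i≤n = trans (cong (binomℤ n) (+m-+n≡+[m∸n] (ℤP.drop‿+≤+ i≤n)))
  (cong +_ (sym (nCk≡nC[n∸k] (ℤP.drop‿+≤+ i≤n))))

-- Linear inequalities over ℤ are proved by certificate: the difference is exhibited as a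
-- sum of known non-negative terms, and the identity is left to the ring solver.
≤-from-gap : ∀ {a b d} → 0ℤ ≤ d → d ≡ b - a → a ≤ b
≤-from-gap 0≤d refl = ℤP.0≤i-j⇒j≤i 0≤d

<-from-gap : ∀ {a b d} → 0ℤ ≤ d → d ≡ b - a - + 1 → a < b
<-from-gap {a} {b} 0≤d refl = ℤP.suc[i]≤j⇒i<j (≤-from-gap 0≤d (shift a b))
  where shift : ∀ a b → b - a - + 1 ≡ b - (+ 1 + a)
        shift = solve-∀

i<j⇒0≤j-i-1 : ∀ {a b} → a < b → 0ℤ ≤ b - a - + 1
i<j⇒0≤j-i-1 {a} {b} a<b = subst (0ℤ ≤_) (shift a b) (i≤j⇒0≤j-i (ℤP.i<j⇒suc[i]≤j a<b))
  where shift : ∀ a b → b - (+ 1 + a) ≡ b - a - + 1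
        shift = solve-∀

i<j⇒0<j-i : ∀ {a b} → a < b → 0ℤ < b - a
i<j⇒0<j-i {a} {b} a<b = <-from-gap (i<j⇒0≤j-i-1 a<b) (shift a b)
  where shift : ∀ a b → b - a - + 1 ≡ b - a - + 0 - + 1
        shift = solve-∀

m<n⇒+m-+n<0 : ∀ {m n} → m ℕ.< n → + m - + n < 0ℤ
m<n⇒+m-+n<0 {m} {n} m<n = <-from-gap (i≤j⇒0≤j-i (+≤+ m<n)) (gap (+ m) (+ n))
  where gap : ∀ m n → n - (+ 1 + m) ≡ 0ℤ - (m - n) - + 1
        gap = solve-∀

module _ (k : ℕ) where

  private
    K : ℕ
    K = suc k

  congᵇ-reflects : ∀ i r → Reflects (+ K ∣ i - r) (congᵇ K i r)
  congᵇ-reflects i r = fromEquivalence congᵇ⇒∣ ∣⇒congᵇ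
    where
    quo : ℤ
    quo = (i - r) ℤ./ℕ K
    rem : ℕ
    rem = (i - r) ℤ.%ℕ K
    i-r≡rem+quo*K : i - r ≡ + rem + quo * + K
    i-r≡rem+quo*K = a≡a%ℕn+[a/ℕn]*n (i - r) K

    congᵇ⇒∣ : T (congᵇ K i r) → + K ∣ i - r
    congᵇ⇒∣ rem≡ᵇ0 = divides quo (begin
      i - r                ≡⟨ i-r≡rem+quo*K ⟩
      + rem + quo * + K    ≡⟨ cong (λ x → + x + quo * + K) (ℕP.≡ᵇ⇒≡ rem 0 rem≡ᵇ0) ⟩
      0ℤ + quo * + K       ≡⟨ ℤP.+-identityˡ (quo * + K) ⟩
      quo * + K            ∎)
      where open ≡-Reasoning

    ∣⇒congᵇ : + K ∣ i - r → T (congᵇ K i r)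
    ∣⇒congᵇ K∣i-r = ℕP.≡⇒≡ᵇ rem 0 (remainder≡0 (∣⇒∣ᵤ K∣rem))
      where
      isolate : ∀ r q K → r + q * K - q * K ≡ r
      isolate = solve-∀
      K∣rem : + K ∣ + rem
      K∣rem = subst (+ K ∣_) (isolate (+ rem) quo (+ K))
        (∣m∣n⇒∣m-n (subst (+ K ∣_) i-r≡rem+quo*K K∣i-r) (divides quo refl))
      remainder≡0 : K ℕ.∣ rem → rem ≡ 0
      remainder≡0 K∣rem with rem | n%ℕd<d (i - r) K
      ... | zero  | _     = refl
      ... | suc _ | rem<K = contradiction K∣rem (ℕ.>⇒∤ rem<K)

  ∣∧>0⇒≥ : ∀ {x} → + K ∣ x → 0ℤ < x → + K ≤ x
  ∣∧>0⇒≥ {+ zero}  _   (+<+ ())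
  ∣∧>0⇒≥ {+ suc x} K∣x _ = +≤+ (ℕ.∣⇒≤ (∣⇒∣ᵤ K∣x))

Δ : (ℤ → ℤ) → ℤ → ℤ
Δ F i = F i - F (i - + 1)

s-[1+j]<s-j : ∀ s j → s - + suc j < s - + j
s-[1+j]<s-j s j = ℤP.+-monoʳ-< s (ℤP.neg-mono-< (+<+ (ℕP.n<1+n j)))

sumWindow-cong : ∀ {f g} s j → (∀ i → s - + j < i → i ≤ s → f i ≡ g i) →
                 sumWindow f s j ≡ sumWindow g s j
sumWindow-cong s zero    _     = refl
sumWindow-cong s (suc j) f≗g = cong₂ _+_ (f≗g (s - + j) (s-[1+j]<s-j s j) (ℤP.i-j≤i s (+ j)))
  (sumWindow-cong s j (λ i j<i i≤s → f≗g i (ℤP.<-trans (s-[1+j]<s-j s j) j<i) i≤s))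

sumWindow-zero : ∀ s j → sumWindow (λ _ → 0ℤ) s j ≡ 0ℤ
sumWindow-zero s zero    = refl
sumWindow-zero s (suc j) = trans (ℤP.+-identityˡ _) (sumWindow-zero s j)

sumWindow-+ : ∀ f g s j → sumWindow (λ i → f i + g i) s j ≡ sumWindow f s j + sumWindow g s j
sumWindow-+ f g s zero    = refl
sumWindow-+ f g s (suc j) =
  trans (cong (λ x → f (s - + j) + g (s - + j) + x) (sumWindow-+ f g s j))
        (interchange (f (s - + j)) (g (s - + j)) (sumWindow f s j) (sumWindow g s j))
  where interchange : ∀ a b c d → a + b + (c + d) ≡ a + c + (b + d)
        interchange = solve-∀

sumWindow-split : ∀ f s a b → sumWindow f s (b ℕ.+ a) ≡ sumWindow f s a + sumWindow f (s - + a) b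
sumWindow-split f s a zero    = sym (ℤP.+-identityʳ _)
sumWindow-split f s a (suc b) =
  trans (cong₂ _+_ (cong f (index s (+ a) (+ b))) (sumWindow-split f s a b))
        (swap (f (s - + a - + b)) (sumWindow f s a) (sumWindow f (s - + a) b))
  where
  index : ∀ s a b → s - (b + a) ≡ s - a - b
  index = solve-∀
  swap : ∀ x y z → x + (y + z) ≡ y + (x + z)
  swap = solve-∀

sumWindow-top : ∀ f s j → sumWindow f s (suc j) ≡ f s + sumWindow f (s - + 1) j
sumWindow-top f s j = begin
  sumWindow f s (suc j)                           ≡⟨ cong (sumWindow f s) (ℕP.+-comm 1 j) ⟩
  sumWindow f s (j ℕ.+ 1)                         ≡⟨ sumWindow-split f s 1 j ⟩
  f (s - + 0) + 0ℤ + sumWindow f (s - + 1) j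
    ≡⟨ cong (_+ sumWindow f (s - + 1) j) (ℤP.+-identityʳ (f (s + 0ℤ))) ⟩
  f (s + 0ℤ) + sumWindow f (s - + 1) j
    ≡⟨ cong (λ x → f x + sumWindow f (s - + 1) j) (ℤP.+-identityʳ s) ⟩
  f s + sumWindow f (s - + 1) j                   ∎
  where open ≡-Reasoning

sumTo≡sumWindow : ∀ f N → sumTo f N ≡ sumWindow f (+ N) (suc N)
sumTo≡sumWindow f zero    = sym (ℤP.+-identityʳ _)
sumTo≡sumWindow f (suc N) =
  trans (cong (λ x → f (+ suc N) + x) (sumTo≡sumWindow f N)) (sym (sumWindow-top f (+ suc N) (suc N)))

sumWindow-reflect : ∀ f c s j → sumWindow f s j ≡ sumWindow (λ i → f (c - i)) (c - s + + j - + 1) j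
sumWindow-reflect f c s zero    = refl
sumWindow-reflect f c s (suc j) = begin
  f (s - + j) + sumWindow f s j
    ≡⟨ cong₂ _+_ (cong f (mirror c s (+ j))) (sumWindow-reflect f c s j) ⟩
  f (c - t) + sumWindow (λ i → f (c - i)) (c - s + + j - + 1) j
    ≡⟨ cong (λ x → f (c - t) + sumWindow (λ i → f (c - i)) x j) (lower c s (+ j)) ⟩
  f (c - t) + sumWindow (λ i → f (c - i)) (t - + 1) j
    ≡⟨ sumWindow-top (λ i → f (c - i)) t j ⟨
  sumWindow (λ i → f (c - i)) t (suc j) ∎
  where
  open ≡-Reasoning
  t : ℤ
  t = c - s + + suc j - + 1
  mirror : ∀ c s j → s - j ≡ c - (c - s + (+ 1 + j) - + 1)
  mirror = solve-∀
  lower : ∀ c s j → c - s + j - + 1 ≡ c - s + (+ 1 + j) - + 1 - + 1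
  lower = solve-∀

sumWindow-telescope : ∀ F s j → sumWindow (Δ F) s j ≡ F s - F (s - + j)
sumWindow-telescope F s zero    =
  sym (trans (cong (λ x → F s - F x) (ℤP.+-identityʳ s)) (ℤP.+-inverseʳ (F s)))
sumWindow-telescope F s (suc j) =
  trans (cong₂ (λ x y → F (s - + j) - F x + y) (index s (+ j)) (sumWindow-telescope F s j))
        (cancel (F s) (F (s - + j)) (F (s - + suc j)))
  where
  index : ∀ s j → s - j - + 1 ≡ s - (+ 1 + j)
  index = solve-∀
  cancel : ∀ a b c → b - c + (a - b) ≡ a - c
  cancel = solve-∀

sumWindow-single : ∀ (f : ℤ → ℤ) {p} s j → s - + j < p → p ≤ s →
  sumWindow (λ i → if does (i ℤ.≟ p) then f i else 0ℤ) s j ≡ f p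
sumWindow-single f s zero    s<p p≤s =
  contradiction p≤s (ℤP.<⇒≱ (subst (_< _) (ℤP.+-identityʳ s) s<p))
sumWindow-single f {p} s (suc j) s-[1+j]<p p≤s with s - + j ℤ.≟ p
... | yes refl = trans
  (cong (λ x → f p + x) (trans (sumWindow-cong {f = indicator} s j others-vanish) (sumWindow-zero s j)))
  (ℤP.+-identityʳ (f p))
  where
  indicator : ℤ → ℤ
  indicator i = if does (i ℤ.≟ p) then f i else 0ℤ
  others-vanish : ∀ i → s - + j < i → i ≤ s → indicator i ≡ 0ℤ
  others-vanish i p<i _ with i ℤ.≟ p
  ... | yes refl = contradiction p<i (ℤP.<-irrefl refl)
  ... | no _     = refl
... | no s-j≢p = trans (ℤP.+-identityˡ _) (sumWindow-single f s j s-j<p p≤s)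
  where
  s-j<p : s - + j < p
  s-j<p = ℤP.≤∧≢⇒< (subst (_≤ p) (next s (+ j)) (ℤP.i<j⇒suc[i]≤j s-[1+j]<p)) s-j≢p
    where next : ∀ s j → + 1 + (s - (+ 1 + j)) ≡ s - j
          next = solve-∀

if-⊎-split : ∀ {A A₁ A₂ : Set} {b b₁ b₂} (x : ℤ) →
             Reflects A b → Reflects A₁ b₁ → Reflects A₂ b₂ →
             (A → A₁ ⊎ A₂) → (A₁ ⊎ A₂ → A) → (A₁ → ¬ A₂) →
             (if b then x else 0ℤ) ≡ (if b₁ then x else 0ℤ) + (if b₂ then x else 0ℤ)
if-⊎-split x (ofʸ _)  (ofʸ a₁)  (ofʸ a₂)  _     _    disjoint = contradiction a₂ (disjoint a₁)
if-⊎-split x (ofʸ _)  (ofʸ _)   (ofⁿ _)   _     _    _        = sym (ℤP.+-identityʳ x)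
if-⊎-split x (ofʸ _)  (ofⁿ _)   (ofʸ _)   _     _    _        = sym (ℤP.+-identityˡ x)
if-⊎-split x (ofʸ a)  (ofⁿ ¬a₁) (ofⁿ ¬a₂) split _    _        with split a
... | inj₁ a₁ = contradiction a₁ ¬a₁
... | inj₂ a₂ = contradiction a₂ ¬a₂
if-⊎-split x (ofⁿ ¬a) (ofʸ a₁)  _         _     join _        = contradiction (join (inj₁ a₁)) ¬a
if-⊎-split x (ofⁿ ¬a) (ofⁿ _)   (ofʸ a₂)  _     join _        = contradiction (join (inj₂ a₂)) ¬a
if-⊎-split x (ofⁿ _)  (ofⁿ _)   (ofⁿ _)   _     _    _        = refl

select : ℕ → ℕ → ℤ → ℤ → ℤ → ℤ
select n k r z i = if congᵇ k i r ∧ does (i ≤? z) then binomℤ n i else 0ℤ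

Sbar≡sumWindow : ∀ n k r z → Sbar n k r z ≡ sumWindow (select n k r z) (+ n) (suc n)
Sbar≡sumWindow n k r z = trans (Sup≡sumTo n) (sumTo≡sumWindow (select n k r z) n)
  where
  Sup≡sumTo : ∀ N → Sup n k r z N ≡ sumTo (select n k r z) N
  Sup≡sumTo zero    = refl
  Sup≡sumTo (suc N) = cong (λ x → select n k r z (+ suc N) + x) (Sup≡sumTo N)

+n-+[1+n]≡-1 : ∀ n → + n - + suc n ≡ -1ℤ
+n-+[1+n]≡-1 n = cancel (+ n)
  where cancel : ∀ n → n - (+ 1 + n) ≡ - + 1
        cancel = solve-∀

[n-[1+n]]<i⇒0≤i : ∀ n {i} → + n - + suc n < i → 0ℤ ≤ i
[n-[1+n]]<i⇒0≤i n {i} n-[1+n]<i = ℤP.i<j⇒suc[i]≤j (subst (_< i) (+n-+[1+n]≡-1 n) n-[1+n]<i)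

0≤i⇒[n-[1+n]]<i : ∀ n {i} → 0ℤ ≤ i → + n - + suc n < i
0≤i⇒[n-[1+n]]<i n 0≤i = subst (_< _) (sym (+n-+[1+n]≡-1 n)) (ℤP.<-≤-trans -<+ 0≤i)

Sdiag : ℕ → ℕ → ℤ → ℤ
Sdiag n k i = Sbar n k i i

Sdiag-neg : ∀ n k {i} → i < 0ℤ → Sdiag n k i ≡ 0ℤ
Sdiag-neg n k {i} i<0 = trans (Sbar≡sumWindow n k i i)
  (trans (sumWindow-cong (+ n) (suc n) unselected) (sumWindow-zero (+ n) (suc n)))
  where
  unselected : ∀ j → + n - + suc n < j → j ≤ + n → select n k i i j ≡ 0ℤ
  unselected j n-[1+n]<j _ = cong (λ b → if b then binomℤ n j else 0ℤ)
    (trans (cong (congᵇ k j i ∧_) (dec-false (j ≤? i) (ℤP.<⇒≱ (ℤP.<-≤-trans i<0 0≤j)))) (∧-zeroʳ _))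
    where
    0≤j : 0ℤ ≤ j
    0≤j = [n-[1+n]]<i⇒0≤i n n-[1+n]<j

Δ-Sdiag-neg : ∀ n k {i} → i < 0ℤ → Δ (Sdiag n k) i ≡ 0ℤ
Δ-Sdiag-neg n k {i} i<0 =
  cong₂ _-_ (Sdiag-neg n k i<0) (Sdiag-neg n k (ℤP.≤-<-trans (ℤP.i-j≤i i (+ 1)) i<0))

module _ (k : ℕ) where

  private
    K : ℕ
    K = suc k

  Selected : ℤ → ℤ → ℤ → Set
  Selected r z i = + K ∣ i - r × i ≤ z

  select-reflects : ∀ r z i → Reflects (Selected r z i) (congᵇ K i r ∧ does (i ≤? z))
  select-reflects r z i = congᵇ-reflects k i r ×-reflects proof (i ≤? z)

  private
    i-K<i : ∀ i → i - + K < i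
    i-K<i i = <-from-gap (+≤+ z≤n) (gap i (+ k))
      where gap : ∀ i k → k ≡ i - (i - (+ 1 + k)) - + 1
            gap = solve-∀

  Selected-rec : ∀ p i → Selected p p i → i ≡ p ⊎ Selected (p - + K) (p - + K) i
  Selected-rec p i (K∣i-p , i≤p) with i ℤ.≟ p
  ... | yes i≡p = inj₁ i≡p
  ... | no  i≢p = inj₂ ( subst (+ K ∣_) (shift i p (+ K)) (∣m∣n⇒∣m+n K∣i-p ∣-refl)
                       , ≤-from-gap (i≤j⇒0≤j-i K≤p-i) (rearrange i p (+ K)))
    where
    shift : ∀ i p K → i - p + K ≡ i - (p - K)
    shift = solve-∀
    negate : ∀ i p → - (i - p) ≡ p - i
    negate = solve-∀
    rearrange : ∀ i p K → p - i - K ≡ p - K - i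
    rearrange = solve-∀
    K≤p-i : + K ≤ p - i
    K≤p-i = ∣∧>0⇒≥ k (subst (+ K ∣_) (negate i p) (∣m⇒∣-m K∣i-p))
                      (i<j⇒0<j-i (ℤP.≤∧≢⇒< i≤p i≢p))

  Selected-rec⁻¹ : ∀ p i → i ≡ p ⊎ Selected (p - + K) (p - + K) i → Selected p p i
  Selected-rec⁻¹ p .p (inj₁ refl) =
    subst (+ K ∣_) (sym (ℤP.+-inverseʳ p)) (divides 0ℤ refl) , ℤP.≤-refl
  Selected-rec⁻¹ p i (inj₂ (K∣i-[p-K] , i≤p-K)) =
      subst (+ K ∣_) (unshift i p (+ K)) (∣m∣n⇒∣m-n K∣i-[p-K] ∣-refl)
    , ℤP.≤-trans i≤p-K (ℤP.i-j≤i p (+ K))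
    where unshift : ∀ i p K → i - (p - K) - K ≡ i - p
          unshift = solve-∀

  Selected-rec-disjoint : ∀ p i → i ≡ p → ¬ Selected (p - + K) (p - + K) i
  Selected-rec-disjoint p .p refl (_ , p≤p-K) = ℤP.<⇒≱ (i-K<i p) p≤p-K

  Selected-sym : ∀ N p i → Selected p N i →
                 Selected p p i ⊎ Selected (N - p - + K) (N - p - + K) (N - i)
  Selected-sym N p i (K∣i-p , _) with i ≤? p
  ... | yes i≤p = inj₁ (K∣i-p , i≤p)
  ... | no  i≰p = inj₂ ( subst (+ K ∣_) (reflect N i p (+ K)) (∣m∣n⇒∣m+n (∣m⇒∣-m K∣i-p) ∣-refl)
                       , ≤-from-gap (i≤j⇒0≤j-i K≤i-p) (rearrange N i p (+ K)))
    where
    reflect : ∀ N i p K → - (i - p) + K ≡ N - i - (N - p - K)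
    reflect = solve-∀
    rearrange : ∀ N i p K → i - p - K ≡ N - p - K - (N - i)
    rearrange = solve-∀
    K≤i-p : + K ≤ i - p
    K≤i-p = ∣∧>0⇒≥ k K∣i-p (i<j⇒0<j-i (ℤP.≰⇒> i≰p))

  Selected-sym⁻¹ : ∀ N p i → i ≤ N →
                   Selected p p i ⊎ Selected (N - p - + K) (N - p - + K) (N - i) → Selected p N i
  Selected-sym⁻¹ N p i i≤N (inj₁ (K∣i-p , _))     = K∣i-p , i≤N
  Selected-sym⁻¹ N p i i≤N (inj₂ (K∣N-i-[N-p-K] , _)) =
      subst (+ K ∣_) (unreflect N i p (+ K)) (∣m∣n⇒∣m+n (∣m⇒∣-m K∣N-i-[N-p-K]) ∣-refl)
    , i≤N
    where unreflect : ∀ N i p K → - (N - i - (N - p - K)) + K ≡ i - p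
          unreflect = solve-∀

  Selected-sym-disjoint : ∀ N p i → Selected p p i → ¬ Selected (N - p - + K) (N - p - + K) (N - i)
  Selected-sym-disjoint N p i (_ , i≤p) (_ , N-i≤N-p-K) =
    ℤP.<⇒≱ (i-K<i (N - p)) (ℤP.≤-trans (ℤP.+-monoʳ-≤ N (ℤP.neg-mono-≤ i≤p)) N-i≤N-p-K)

  Sdiag-rec : ∀ n {p} → 0ℤ ≤ p → p ≤ + n → Sdiag n K p ≡ binomℤ n p + Sdiag n K (p - + K)
  Sdiag-rec n {p} 0≤p p≤n = begin
    Sdiag n K p
      ≡⟨ Sbar≡sumWindow n K p p ⟩
    sumWindow (select n K p p) (+ n) (suc n)
      ≡⟨ sumWindow-cong (+ n) (suc n) split ⟩
    sumWindow (λ i → single i + select n K q q i) (+ n) (suc n)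
      ≡⟨ sumWindow-+ single (select n K q q) (+ n) (suc n) ⟩
    sumWindow single (+ n) (suc n) + sumWindow (select n K q q) (+ n) (suc n)
      ≡⟨ cong₂ _+_ (sumWindow-single (binomℤ n) (+ n) (suc n) (0≤i⇒[n-[1+n]]<i n 0≤p) p≤n)
                   (sym (Sbar≡sumWindow n K q q)) ⟩
    binomℤ n p + Sdiag n K q
      ∎
    where
    open ≡-Reasoning
    q : ℤ
    q = p - + K
    single : ℤ → ℤ
    single i = if does (i ℤ.≟ p) then binomℤ n i else 0ℤ
    split : ∀ i → + n - + suc n < i → i ≤ + n → select n K p p i ≡ single i + select n K q q i
    split i _ _ =
      if-⊎-split (binomℤ n i) (select-reflects p p i) (proof (i ℤ.≟ p)) (select-reflects q q i)
        (Selected-rec p i) (Selected-rec⁻¹ p i) (Selected-rec-disjoint p i)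

  Sdiag-sym : ∀ n p → S n K p ≡ Sdiag n K p + Sdiag n K (+ n - p - + K)
  Sdiag-sym n p = begin
    S n K p
      ≡⟨ Sbar≡sumWindow n K p N ⟩
    sumWindow (select n K p N) N (suc n)
      ≡⟨ sumWindow-cong N (suc n) split ⟩
    sumWindow (λ i → select n K p p i + mirrored i) N (suc n)
      ≡⟨ sumWindow-+ (select n K p p) mirrored N (suc n) ⟩
    sumWindow (select n K p p) N (suc n) + sumWindow mirrored N (suc n)
      ≡⟨ cong₂ _+_ (Sbar≡sumWindow n K p p) (trans (Sbar≡sumWindow n K r r) reflected) ⟨
    Sdiag n K p + Sdiag n K r
      ∎
    where
    open ≡-Reasoning
    N r : ℤ
    N = + n
    r = N - p - + K
    mirrored : ℤ → ℤ
    mirrored i = select n K r r (N - i)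
    split : ∀ i → N - + suc n < i → i ≤ N → select n K p N i ≡ select n K p p i + mirrored i
    split i bottom<i i≤N = trans
      (if-⊎-split (binomℤ n i) (select-reflects p N i) (select-reflects p p i) (select-reflects r r (N - i))
        (Selected-sym N p i) (Selected-sym⁻¹ N p i i≤N) (Selected-sym-disjoint N p i))
      (cong (λ x → select n K p p i + (if congᵇ K (N - i) r ∧ does (N - i ≤? r) then x else 0ℤ))
        (sym (binomℤ-sym n ([n-[1+n]]<i⇒0≤i n bottom<i) i≤N)))
    top : ∀ n → n - n + (+ 1 + n) - + 1 ≡ n
    top = solve-∀
    reflected : sumWindow (select n K r r) N (suc n) ≡ sumWindow mirrored N (suc n)
    reflected = trans (sumWindow-reflect (select n K r r) N N (suc n))
                      (cong (λ t → sumWindow mirrored t (suc n)) (top N))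

  Sdiag-increasing : ∀ n p → 2 ℕ.* p ℕ.< n → Sdiag n K (+ p - + 1) < Sdiag n K (+ p)
  Sdiag-increasing n = <-rec _ step
    where
    step : ∀ p → (∀ {q} → q ℕ.< p → 2 ℕ.* q ℕ.< n → Sdiag n K (+ q - + 1) < Sdiag n K (+ q)) →
           2 ℕ.* p ℕ.< n → Sdiag n K (+ p - + 1) < Sdiag n K (+ p)
    step zero _ _ = subst₂ _<_
      (sym (Sdiag-neg n K -<+))
      (sym (trans (Sdiag-rec n ℤP.≤-refl (+≤+ z≤n)) (cong (λ x → + 1 + x) (Sdiag-neg n K -<+))))
      (+<+ (s≤s z≤n))
    step (suc q) rec 2[1+q]<n = subst₂ _<_
      (sym (Sdiag-rec n (+≤+ z≤n) (+≤+ q≤n)))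
      (sym (Sdiag-rec n (+≤+ z≤n) (+≤+ 1+q≤n)))
      (ℤP.+-mono-<-≤ (+<+ (nCk<nC[1+k] (ℕP.<⇒≤ 2[1+q]<n))) earlier≤later)
      where
      1+q≤n : suc q ℕ.≤ n
      1+q≤n = ℕP.≤-trans (ℕP.m≤m+n (suc q) _) (ℕP.<⇒≤ 2[1+q]<n)
      q≤n : q ℕ.≤ n
      q≤n = ℕP.≤-trans (ℕP.n≤1+n q) 1+q≤n
      earlier≤later : Sdiag n K (+ q - + K) ≤ Sdiag n K (+ suc q - + K)
      earlier≤later with K ℕ.≤? suc q
      ... | no  K≰1+q = ℤP.≤-reflexive (trans
            (Sdiag-neg n K (m<n⇒+m-+n<0 (ℕP.<-trans (ℕP.n<1+n q) (ℕP.≰⇒> K≰1+q))))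
            (sym (Sdiag-neg n K (m<n⇒+m-+n<0 (ℕP.≰⇒> K≰1+q)))))
      ... | yes K≤1+q = subst₂ _≤_
            (cong (Sdiag n K) (trans (cong (_- + 1) r≡) (shift (+ q) (+ K))))
            (cong (Sdiag n K) r≡)
            (ℤP.<⇒≤ (rec (s≤s (ℕP.m∸n≤m q k)) 2r<n))
        where
        r : ℕ
        r = q ℕ.∸ k
        r≡ : + r ≡ + suc q - + K
        r≡ = sym (+m-+n≡+[m∸n] K≤1+q)
        2r<n : 2 ℕ.* r ℕ.< n
        2r<n = ℕP.≤-<-trans (ℕP.*-monoʳ-≤ 2 (ℕP.≤-trans (ℕP.m∸n≤m q k) (ℕP.n≤1+n q))) 2[1+q]<n
        shift : ∀ q K → (+ 1 + q) - K - + 1 ≡ q - K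
        shift = solve-∀

  Δ-Sdiag-pos : ∀ n {t} → 0ℤ ≤ t → t + t < + n → 0ℤ < Δ (Sdiag n K) t
  Δ-Sdiag-pos n {+ p} _ 2p<n = i<j⇒0<j-i (Sdiag-increasing n p
    (subst (ℕ._< n) (cong (p ℕ.+_) (sym (ℕP.+-identityʳ p))) (ℤP.drop‿+<+ 2p<n)))

module _ (n k : ℕ) where

  private
    N M c : ℤ
    N = + n
    M = + mOf n k
    c = N - + k + + 1
    D : ℤ → ℤ
    D = Sdiag n k
    branches : Bool → ℤ → ℤ
    branches b i = if b then Δ D i else Δ D (N - i - + k + + 1)

  w-low : ∀ {i} → i ≤ M → w n k i ≡ Δ D i
  w-low {i} i≤M = cong (λ b → branches b i) (dec-true (i ≤? M) i≤M)

  w-high : ∀ {i} → M < i → w n k i ≡ Δ D (c - i)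
  w-high {i} M<i = trans (cong (λ b → branches b i) (dec-false (i ≤? M) (ℤP.<⇒≱ M<i)))
                         (cong (Δ D) (reorder N i (+ k)))
    where reorder : ∀ N i K → N - i - K + + 1 ≡ N - K + + 1 - i
          reorder = solve-∀

  sumWindow-w-low : ∀ {s} j → s ≤ M → sumWindow (w n k) s j ≡ D s - D (s - + j)
  sumWindow-w-low {s} j s≤M =
    trans (sumWindow-cong s j (λ i _ i≤s → w-low (ℤP.≤-trans i≤s s≤M))) (sumWindow-telescope D s j)

  sumWindow-w-high : ∀ {s} j → M + + j ≤ s →
                     sumWindow (w n k) s j ≡ D (N - + k - s + + j) - D (N - + k - s)
  sumWindow-w-high {s} j M+j≤s = begin
    sumWindow (w n k) s j
      ≡⟨ sumWindow-cong s j (λ i s-j<i _ → w-high (M<i s-j<i)) ⟩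
    sumWindow (λ i → Δ D (c - i)) s j
      ≡⟨ sumWindow-reflect (λ i → Δ D (c - i)) c s j ⟩
    sumWindow (λ i → Δ D (c - (c - i))) t j
      ≡⟨ sumWindow-cong t j (λ i _ _ → cong (Δ D) (involution c i)) ⟩
    sumWindow (Δ D) t j
      ≡⟨ sumWindow-telescope D t j ⟩
    D t - D (t - + j)
      ≡⟨ cong₂ (λ x y → D x - D y) (top N (+ k) s (+ j)) (bottom N (+ k) s (+ j)) ⟩
    D (N - + k - s + + j) - D (N - + k - s)
      ∎
    where
    open ≡-Reasoning
    t : ℤ
    t = c - s + + j - + 1
    M<i : ∀ {i} → s - + j < i → M < i
    M<i = ℤP.≤-<-trans (≤-from-gap (i≤j⇒0≤j-i M+j≤s) (rearrange M s (+ j)))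
      where rearrange : ∀ M s j → s - (M + j) ≡ s - j - M
            rearrange = solve-∀
    involution : ∀ c i → c - (c - i) ≡ i
    involution = solve-∀
    top : ∀ N K s j → N - K + + 1 - s + j - + 1 ≡ N - K - s + j
    top = solve-∀
    bottom : ∀ N K s j → N - K + + 1 - s + j - + 1 - j ≡ N - K - s
    bottom = solve-∀

  sumWindow-w-straddle : ∀ {s} j → M ≤ s → s ≤ M + + j →
    sumWindow (w n k) s j ≡ (D (N - + k - M) - D (N - + k - s)) + (D M - D (s - + j))
  sumWindow-w-straddle {s} j M≤s s≤M+j = begin
    sumWindow (w n k) s j
      ≡⟨ cong (sumWindow (w n k) s) (sym b+a≡j) ⟩
    sumWindow (w n k) s (b ℕ.+ a)
      ≡⟨ sumWindow-split (w n k) s a b ⟩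
    sumWindow (w n k) s a + sumWindow (w n k) (s - + a) b
      ≡⟨ cong₂ _+_ (sumWindow-w-high a (ℤP.≤-reflexive M+a≡s))
                   (cong (λ x → sumWindow (w n k) x b) s-a≡M) ⟩
    (D (N - + k - s + + a) - D (N - + k - s)) + sumWindow (w n k) M b
      ≡⟨ cong₂ (λ x y → (D x - D (N - + k - s)) + y) upper-end (sumWindow-w-low b ℤP.≤-refl) ⟩
    (D (N - + k - M) - D (N - + k - s)) + (D M - D (M - + b))
      ≡⟨ cong (λ x → (D (N - + k - M) - D (N - + k - s)) + (D M - D x)) lower-end ⟩
    (D (N - + k - M) - D (N - + k - s)) + (D M - D (s - + j))
      ∎
    where
    open ≡-Reasoning
    a b : ℕ
    a = ∣ s - M ∣
    b = j ℕ.∸ a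
    +a≡s-M : + a ≡ s - M
    +a≡s-M = ℤP.0≤i⇒+∣i∣≡i (i≤j⇒0≤j-i M≤s)
    a≤j : a ℕ.≤ j
    a≤j = ℤP.drop‿+≤+ (subst (_≤ + j) (sym +a≡s-M)
                             (≤-from-gap (i≤j⇒0≤j-i s≤M+j) (gap M s (+ j))))
      where gap : ∀ M s j → M + j - s ≡ j - (s - M)
            gap = solve-∀
    b+a≡j : b ℕ.+ a ≡ j
    b+a≡j = ℕP.m∸n+n≡m a≤j
    M+a≡s : M + + a ≡ s
    M+a≡s = trans (cong (λ x → M + x) +a≡s-M) (cancel M s)
      where cancel : ∀ M s → M + (s - M) ≡ s
            cancel = solve-∀
    s-a≡M : s - + a ≡ M
    s-a≡M = trans (cong (λ x → s - x) +a≡s-M) (cancel M s)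
      where cancel : ∀ M s → s - (s - M) ≡ M
            cancel = solve-∀
    upper-end : N - + k - s + + a ≡ N - + k - M
    upper-end = trans (cong (λ x → N - + k - s + x) +a≡s-M) (cancel N (+ k) M s)
      where cancel : ∀ N k M s → N - k - s + (s - M) ≡ N - k - M
            cancel = solve-∀
    lower-end : M - + b ≡ s - + j
    lower-end = trans
      (cong (λ x → M - x) (trans (sym (+m-+n≡+[m∸n] a≤j)) (cong (λ x → + j - x) +a≡s-M)))
      (cancel M s (+ j))
      where cancel : ∀ M s j → M - (j - (s - M)) ≡ s - j
            cancel = solve-∀

mOf-bounds : ∀ n k → k ℕ.≤ n →
             (+ mOf n k + + mOf n k ≤ + n - + k + + 1) × (+ n - + k ≤ + mOf n k + + mOf n k)
mOf-bounds n k k≤n =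
    subst₂ _≤_ (ℤP.pos-+ m m) x≡ (+≤+ 2m≤x)
  , subst₂ _≤_ (sym (+m-+n≡+[m∸n] k≤n)) (ℤP.pos-+ m m) (+≤+ n∸k≤2m)
  where
  x m : ℕ
  x = n ℕ.∸ k ℕ.+ 1
  m = mOf n k
  x≡ : + x ≡ + n - + k + + 1
  x≡ = trans (ℤP.pos-+ (n ℕ.∸ k) 1) (cong (_+ + 1) (sym (+m-+n≡+[m∸n] k≤n)))
  double : ∀ m → m ℕ.* 2 ≡ m ℕ.+ m
  double = ℕ-Solver.solve-∀
  2m≤x : m ℕ.+ m ℕ.≤ x
  2m≤x = subst (ℕ._≤ x) (double m) (m/n*n≤m x 2)
  n∸k≤2m : n ℕ.∸ k ℕ.≤ m ℕ.+ m
  n∸k≤2m = subst (n ℕ.∸ k ℕ.≤_) (double m) (ℕP.≤-pred (begin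
    suc (n ℕ.∸ k)          ≡⟨ ℕP.+-comm 1 (n ℕ.∸ k) ⟩
    x                      ≡⟨ m≡m%n+[m/n]*n x 2 ⟩
    x ℕ.% 2 ℕ.+ m ℕ.* 2    ≤⟨ ℕP.+-monoˡ-≤ (m ℕ.* 2) (ℕP.≤-pred (m%n<n x 2)) ⟩
    suc (m ℕ.* 2)          ∎))
    where open ℕP.≤-Reasoning

module _ (n k : ℕ) (1≤k : 1 ℕ.≤ k) (K≤n : suc k ℕ.≤ n) where

  private
    K : ℕ
    K = suc k
    N M c : ℤ
    N = + n
    M = + mOf n K
    c = N - + K + + 1
    D : ℤ → ℤ
    D = Sdiag n K

    2M≤c : M + M ≤ c
    2M≤c = proj₁ (mOf-bounds n K K≤n)

    c-1≤2M : N - + K ≤ M + M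
    c-1≤2M = proj₂ (mOf-bounds n K K≤n)

    0≤M : 0ℤ ≤ M
    0≤M = +≤+ z≤n

    0≤K-2 : 0ℤ ≤ + K - + 2
    0≤K-2 = i≤j⇒0≤j-i (+≤+ (s≤s 1≤k))

    M≤c : M ≤ c
    M≤c = ≤-from-gap (ℤP.+-mono-≤ (i≤j⇒0≤j-i 2M≤c) 0≤M) (gap c M)
      where gap : ∀ c M → c - (M + M) + M ≡ c - M
            gap = solve-∀

    M≤N : M ≤ N
    M≤N = ≤-from-gap (ℤP.+-mono-≤ (ℤP.+-mono-≤ (i≤j⇒0≤j-i M≤c) 0≤K-2) (+≤+ z≤n))
                     (gap N (+ K) M)
      where gap : ∀ N K M → N - K + + 1 - M + (K - + 2) + + 1 ≡ N - M
            gap = solve-∀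

    +[n∸K]+1≡c : + (n ℕ.∸ K) + + 1 ≡ c
    +[n∸K]+1≡c = cong (_+ + 1) (sym (+m-+n≡+[m∸n] K≤n))

  w-vanishes : ∀ s → (s < 0ℤ ⊎ s > + (n ℕ.∸ K) + + 1) → w n K s ≡ 0ℤ
  w-vanishes s (inj₁ s<0) = trans (w-low n K (ℤP.<⇒≤ (ℤP.<-≤-trans s<0 0≤M))) (Δ-Sdiag-neg n K s<0)
  w-vanishes s (inj₂ c<s) =
    trans (w-high n K (ℤP.≤-<-trans M≤c c<s′)) (Δ-Sdiag-neg n K (<-from-gap (i<j⇒0≤j-i-1 c<s′) (gap c s)))
    where
    c<s′ : c < s
    c<s′ = subst (_< s) +[n∸K]+1≡c c<s
    gap : ∀ c s → s - c - + 1 ≡ 0ℤ - (c - s) - + 1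
    gap = solve-∀

  w-positive : ∀ s → (0ℤ ≤ s × s ≤ + (n ℕ.∸ K) + + 1) → w n K s > 0ℤ
  w-positive s (0≤s , s≤c) = by-cases (s ≤? M)
    where
    sum4 : ∀ {a b c d} → 0ℤ ≤ a → 0ℤ ≤ b → 0ℤ ≤ c → 0ℤ ≤ d → 0ℤ ≤ a + b + c + d
    sum4 p q r t = ℤP.+-mono-≤ (ℤP.+-mono-≤ (ℤP.+-mono-≤ p q) r) t
    low-gap : ∀ N K M s → M - s + (M - s) + (N - K + + 1 - (M + M)) + (K - + 2)
                          ≡ N - (s + s) - + 1
    low-gap = solve-∀
    high-gap : ∀ N K M s → s - M - + 1 + (s - M - + 1) + (M + M - (N - K)) + (K - + 2 + + 1)
                           ≡ N - (N - K + + 1 - s + (N - K + + 1 - s)) - + 1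
    high-gap = solve-∀
    by-cases : Dec (s ≤ M) → w n K s > 0ℤ
    by-cases (yes s≤M) = subst (0ℤ <_) (sym (w-low n K s≤M)) (Δ-Sdiag-pos k n 0≤s (<-from-gap
      (sum4 (i≤j⇒0≤j-i s≤M) (i≤j⇒0≤j-i s≤M) (i≤j⇒0≤j-i 2M≤c) 0≤K-2)
      (low-gap N (+ K) M s)))
    by-cases (no s≰M) = subst (0ℤ <_) (sym (w-high n K M<s)) (Δ-Sdiag-pos k n 0≤c-s (<-from-gap
      (sum4 (i<j⇒0≤j-i-1 M<s) (i<j⇒0≤j-i-1 M<s) (i≤j⇒0≤j-i c-1≤2M) (ℤP.+-mono-≤ 0≤K-2 (+≤+ z≤n)))
      (high-gap N (+ K) M s)))
      where
      0≤c-s : 0ℤ ≤ c - s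
      0≤c-s = i≤j⇒0≤j-i (subst (s ≤_) +[n∸K]+1≡c s≤c)
      M<s : M < s
      M<s = ℤP.≰⇒> s≰M

  sumWindow-w≡binomℤ : ∀ s → ((0ℤ ≤ s × s ≤ M) ⊎ (M + + K ≤ s × s ≤ N)) →
                       sumWindow (w n K) s K ≡ binomℤ n s
  sumWindow-w≡binomℤ s (inj₁ (0≤s , s≤M)) = begin
    sumWindow (w n K) s K
      ≡⟨ sumWindow-w-low n K K s≤M ⟩
    D s - D (s - + K)
      ≡⟨ cong (_- D (s - + K)) (Sdiag-rec k n 0≤s (ℤP.≤-trans s≤M M≤N)) ⟩
    binomℤ n s + D (s - + K) - D (s - + K)
      ≡⟨ cancel (binomℤ n s) (D (s - + K)) ⟩
    binomℤ n s
      ∎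
    where
    open ≡-Reasoning
    cancel : ∀ a b → a + b - b ≡ a
    cancel = solve-∀
  sumWindow-w≡binomℤ s (inj₂ (M+K≤s , s≤N)) = begin
    sumWindow (w n K) s K
      ≡⟨ sumWindow-w-high n K K M+K≤s ⟩
    D (N - + K - s + + K) - D (N - + K - s)
      ≡⟨ cong₂ (λ x y → D x - D y) (top N (+ K) s) (bottom N (+ K) s) ⟩
    D (N - s) - D (N - s - + K)
      ≡⟨ cong (_- D (N - s - + K)) (Sdiag-rec k n (i≤j⇒0≤j-i s≤N) N-s≤N) ⟩
    binomℤ n (N - s) + D (N - s - + K) - D (N - s - + K)
      ≡⟨ cancel (binomℤ n (N - s)) (D (N - s - + K)) ⟩
    binomℤ n (N - s)
      ≡⟨ binomℤ-sym n 0≤s s≤N ⟩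
    binomℤ n s
      ∎
    where
    open ≡-Reasoning
    cancel : ∀ a b → a + b - b ≡ a
    cancel = solve-∀
    top : ∀ N K s → N - K - s + K ≡ N - s
    top = solve-∀
    bottom : ∀ N K s → N - K - s ≡ N - s - K
    bottom = solve-∀
    0≤s : 0ℤ ≤ s
    0≤s = ℤP.≤-trans (ℤP.≤-trans 0≤M (ℤP.i≤i+j M (+ K))) M+K≤s
    N-s≤N : N - s ≤ N
    N-s≤N = ≤-from-gap 0≤s (gap N s)
      where gap : ∀ N s → s ≡ N - (N - s)
            gap = solve-∀

  sumWindow-w≡S-S+binomℤ : ∀ s → (M < s × s < M + + K) →
                            sumWindow (w n K) s K ≡ S n K M - S n K s + binomℤ n s
  sumWindow-w≡S-S+binomℤ s (M<s , s<M+K) = begin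
    sumWindow (w n K) s K
      ≡⟨ sumWindow-w-straddle n K K (ℤP.<⇒≤ M<s) (ℤP.<⇒≤ s<M+K) ⟩
    (D (N - + K - M) - D (N - + K - s)) + (D M - D (s - + K))
      ≡⟨ cong₂ (λ x y → (D x - D y) + (D M - D (s - + K))) (swap N (+ K) M) (swap N (+ K) s) ⟩
    (D (N - M - + K) - D (N - s - + K)) + (D M - D (s - + K))
      ≡⟨ regroup (D (N - M - + K)) (D (N - s - + K)) (D M) (D (s - + K)) (binomℤ n s) ⟩
    (D M + D (N - M - + K)) - ((binomℤ n s + D (s - + K)) + D (N - s - + K)) + binomℤ n s
      ≡⟨ cong₂ (λ x y → x - (y + D (N - s - + K)) + binomℤ n s)
               (Sdiag-sym k n M) (Sdiag-rec k n 0≤s s≤N) ⟨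
    S n K M - (D s + D (N - s - + K)) + binomℤ n s
      ≡⟨ cong (λ x → S n K M - x + binomℤ n s) (Sdiag-sym k n s) ⟨
    S n K M - S n K s + binomℤ n s
      ∎
    where
    open ≡-Reasoning
    swap : ∀ N K M → N - K - M ≡ N - M - K
    swap = solve-∀
    regroup : ∀ A B C E c → (A - B) + (C - E) ≡ (C + A) - ((c + E) + B) + c
    regroup = solve-∀
    0≤s : 0ℤ ≤ s
    0≤s = ℤP.<⇒≤ (ℤP.≤-<-trans 0≤M M<s)
    s≤N : s ≤ N
    s≤N = ≤-from-gap (ℤP.+-mono-≤ (i≤j⇒0≤j-i M≤c) (i<j⇒0≤j-i-1 s<M+K)) (gap N (+ K) M s)
      where gap : ∀ N K M s → N - K + + 1 - M + (M + K - s - + 1) ≡ N - s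
            gap = solve-∀

  sumTo-w≡S : sumTo (w n K) (n ℕ.∸ K ℕ.+ 1) ≡ S n K M
  sumTo-w≡S = begin
    sumTo (w n K) X
      ≡⟨ sumTo≡sumWindow (w n K) X ⟩
    sumWindow (w n K) (+ X) (suc X)
      ≡⟨ sumWindow-w-straddle n K (suc X) M≤X X≤M+1+X ⟩
    (D (N - + K - M) - D (N - + K - + X)) + (D M - D (+ X - + suc X))
      ≡⟨ cong₂ (λ x y → (D (N - + K - M) - D x) + (D M - D y)) below-0 (+n-+[1+n]≡-1 X) ⟩
    (D (N - + K - M) - D -1ℤ) + (D M - D -1ℤ)
      ≡⟨ cong₂ (λ x y → (D x - y) + (D M - y)) (swap N (+ K) M) (Sdiag-neg n K -<+) ⟩
    (D (N - M - + K) - 0ℤ) + (D M - 0ℤ)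
      ≡⟨ regroup (D (N - M - + K)) (D M) ⟩
    D M + D (N - M - + K)
      ≡⟨ Sdiag-sym k n M ⟨
    S n K M
      ∎
    where
    open ≡-Reasoning
    X : ℕ
    X = n ℕ.∸ K ℕ.+ 1
    X≡c : + X ≡ c
    X≡c = trans (ℤP.pos-+ (n ℕ.∸ K) 1) +[n∸K]+1≡c
    M≤X : M ≤ + X
    M≤X = subst (M ≤_) (sym X≡c) M≤c
    X≤M+1+X : + X ≤ M + + suc X
    X≤M+1+X = ℤP.≤-trans (ℤP.i≤j+i (+ X) M) (ℤP.+-monoʳ-≤ M (+≤+ (ℕP.n≤1+n X)))
    below-0 : N - + K - + X ≡ -1ℤ
    below-0 = trans (cong (λ x → N - + K - x) X≡c) (gap N (+ K))
      where gap : ∀ N K → N - K - (N - K + + 1) ≡ - + 1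
            gap = solve-∀
    swap : ∀ N K M → N - K - M ≡ N - M - K
    swap = solve-∀
    regroup : ∀ A C → (A - 0ℤ) + (C - 0ℤ) ≡ C + A
    regroup = solve-∀

lemma4 : (n k : ℕ) → 2 ℕ.≤ k → k ℕ.≤ n → (s : ℤ) →
    ((s < + 0 ⊎ s > + (n ℕ.∸ k) + + 1) → w n k s ≡ + 0)
    × ((+ 0 ≤ s × s ≤ + (n ℕ.∸ k) + + 1) → w n k s > + 0)
    × (((+ 0 ≤ s × s ≤ + mOf n k) ⊎ (+ mOf n k + + k ≤ s × s ≤ + n)) →
        sumWindow (w n k) s k ≡ binomℤ n s)
    × ((+ mOf n k < s × s < + mOf n k + + k) →
        sumWindow (w n k) s k ≡ S n k (+ mOf n k) - S n k s + binomℤ n s)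
    × (sumTo (w n k) (n ℕ.∸ k ℕ.+ 1) ≡ S n k (+ mOf n k))
lemma4 n (suc k) (s≤s 1≤k) K≤n s =
    w-vanishes n k 1≤k K≤n s
  , w-positive n k 1≤k K≤n s
  , sumWindow-w≡binomℤ n k 1≤k K≤n s
  , sumWindow-w≡S-S+binomℤ n k 1≤k K≤n s
  , sumTo-w≡S n k 1≤k K≤n
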